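{- Let $G$ be a connected loopless multigraph and let $T$ be a Tr\'emaux tree of $G$. If $G$ admits an F-coloring with respect to $T$, then $G$ admits a strong F-coloring with respect to $T$.
   Context: A rooted spanning tree $T$ of $G$ (root $r$) defines a partial order $\preceq$ on $V(G)$: $x\preceq y$ if the tree path from $y$ to $r$ contains $x$. $T$ is a Tr\'emaux tree if every edge of $G$ not in $T$ (cotree edge) joins two $\preceq$-comparable vertices; cotree edges are then called back-edges. Edges are oriented: a tree edge $\{x,y\}$ with $x\prec y$ is oriented $(x,y)$, and a back-edge $\{x,y\}$ with $x\prec y$ is oriented $(y,x)$. For a vertex $v$, ${\omega^+}(v)$ denotes the set of edges oriented out of $v$. The order is extended to $V(G)\cup E(G)$: for each edge $e=(x,y)$ (oriented from $x$ to $y$) put $x\prec e$, and if $e$ is a tree edge also put $e\prec y$; take the transitive closure. For $\alpha\in V(G)\cup E(G)$, ${\rm low}(\alpha)=\min\bigl(\{\alpha\}\cup\{v\in V(G):\exists\text{ back-edge }(u,v)\succeq\alpha\}\bigr)$. For an edge $e=(x,y)$, ${\rm Fringe}(e)=\{f\text{ back-edge}: f\succeq e,\ {\rm low}(f)\prec x\}$. For a vertex $v$ and $e_1,e_2\in{\omega^+}(v)$, ${\rm Interlaced}(e_1,e_2)=\{f\in{\rm Fringe}(e_1):{\rm low}(f)\succ{\rm low}(e_2)\}$. A map $\lambda$ from the set of back-edges to $\{ -1,1\}$ is an F-coloring if for every vertex $v$ and all distinct $e_1,e_2\in{\omega^+}(v)$, all edges of ${\rm Interlaced}(e_1,e_2)$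 receive the same color, all edges of ${\rm Interlaced}(e_2,e_1)$ receive the same color, and every edge of the first set receives a different color from every edge of the second. For a vertex $v$, the low set is ${\rm L}(v)=\{f\text{ back-edge}: f\succeq v,\ {\rm low}(f)={\rm low}(v)\}$. An F-coloring is strong if ${\rm L}(v)$ is monochromatic for every vertex $v$. -}

module Defs where

open import Data.Nat using (ℕ)
open import Data.Fin using (Fin)
open import Data.Maybe using (Maybe; just; nothing)
open import Data.Product using (Σ; ∃; ∃-syntax; _×_; _,_; proj₁; proj₂)
open import Data.Sum using (_⊎_; inj₁; inj₂)
open import Data.Sign using (Sign)
open import Relation.Binary.PropositionalEquality using (_≡_; _≢_)
open import Relation.Nullary using (¬_)
open import Relation.Binary.Construct.Closure.ReflexiveTransitive using (Star)

-- A finite multigraph with vertex set Fin n and edge set Fin m;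
-- ends e = the two (unordered) endpoints of edge e.  Parallel edges allowed.
record Multigraph (n m : ℕ) : Set where
  field
    ends : Fin m → Fin n × Fin n

module _ {n m : ℕ} (G : Multigraph n m) where
  open Multigraph G

  Loopless : Set
  Loopless = ∀ (e : Fin m) → proj₁ (ends e) ≢ proj₂ (ends e)

  Joins : Fin m → Fin n → Fin n → Set
  Joins e x y = ends e ≡ (x , y) ⊎ ends e ≡ (y , x)

  Adjacent : Fin n → Fin n → Set
  Adjacent x y = ∃[ e ] Joins e x y

  Connected : Set
  Connected = ∀ (x y : Fin n) → Star Adjacent x y

  -- A rooted spanning tree, given by its root and, for each vertex v ≠ root,
  -- the tree edge joining v to its parent.  Every vertex must reach the root
  -- by following parents (so there are no cycles).
  record RootedSpanningTree : Set where
    field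
      root      : Fin n
      up        : Fin n → Maybe (Fin m)
      up-root   : up root ≡ nothing
      up-other  : ∀ v → v ≢ root → ∃[ e ] up v ≡ just e
      up-incid  : ∀ v e → up v ≡ just e → ∃[ p ] Joins e p v

    Parent : Fin n → Fin n → Set
    Parent p v = ∃[ e ] (up v ≡ just e × Joins e p v)

    -- Anc x y : x ⪯ y, i.e. x lies on the tree path from y to the root
    Anc : Fin n → Fin n → Set
    Anc = Star Parent

    field
      reaches-root : ∀ v → Anc root v

module _ {n m : ℕ} {G : Multigraph n m} (T : RootedSpanningTree G) where
  open Multigraph G
  open RootedSpanningTree T

  IsTree : Fin m → Set
  IsTree e = ∃[ v ] up v ≡ just e

  IsBack : Fin m → Set
  IsBack e = ¬ IsTree e

  Tremaux : Set
  Tremaux = ∀ e → IsBack e → Anc (proj₁ (ends e)) (proj₂ (ends e))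
                            ⊎ Anc (proj₂ (ends e)) (proj₁ (ends e))

  Oriented : Fin m → Fin n → Fin n → Set
  Oriented e x y = Joins G e x y × ((IsTree e × Anc x y) ⊎ (IsBack e × Anc y x))

  OutOf : Fin n → Fin m → Set
  OutOf v e = ∃[ y ] Oriented e v y

  Elt : Set
  Elt = Fin n ⊎ Fin m

  data Step : Elt → Elt → Set where
    tail≺e : ∀ {x e y} → Oriented e x y → Step (inj₁ x) (inj₂ e)
    e≺head : ∀ {x e y} → IsTree e → Oriented e x y → Step (inj₂ e) (inj₁ y)

  _⪯_ : Elt → Elt → Set
  _⪯_ = Star Step

  _≺_ : Elt → Elt → Set
  a ≺ b = a ⪯ b × a ≢ b

  LowSet : Elt → Elt → Set
  LowSet α β = β ≡ α ⊎ (∃[ v ] (β ≡ inj₁ v × ∃[ f ] ∃[ u ] (IsBack f × Oriented f u v × α ⪯ inj₂ f)))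

  IsLow : Elt → Elt → Set
  IsLow α β = LowSet α β × (∀ γ → LowSet α γ → β ⪯ γ)

  Fringe : Fin m → Fin m → Set
  Fringe e f = IsBack f × inj₂ e ⪯ inj₂ f
             × ∃[ x ] (OutOf x e × ∃[ β ] (IsLow (inj₂ f) β × β ≺ inj₁ x))

  Interlaced : Fin m → Fin m → Fin m → Set
  Interlaced e₁ e₂ f = Fringe e₁ f
    × ∃[ β ] ∃[ γ ] (IsLow (inj₂ f) β × IsLow (inj₂ e₂) γ × γ ≺ β)

  -- colorings: values on tree edges are irrelevant (only back-edges are constrained)
  FColoring : (Fin m → Sign) → Set
  FColoring λc = ∀ v e₁ e₂ → OutOf v e₁ → OutOf v e₂ → e₁ ≢ e₂ →
      (∀ f g → Interlaced e₁ e₂ f → Interlaced e₁ e₂ g → λc f ≡ λc g)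
    × (∀ f g → Interlaced e₂ e₁ f → Interlaced e₂ e₁ g → λc f ≡ λc g)
    × (∀ f g → Interlaced e₁ e₂ f → Interlaced e₂ e₁ g → λc f ≢ λc g)

  LowSetOf : Fin n → Fin m → Set
  LowSetOf v f = IsBack f × inj₁ v ⪯ inj₂ f
    × ∃[ β ] (IsLow (inj₂ f) β × IsLow (inj₁ v) β)

  StrongFColoring : (Fin m → Sign) → Set
  StrongFColoring λc = FColoring λc
    × (∀ v f g → LowSetOf v f → LowSetOf v g → λc f ≡ λc g)

{-# OPTIONS --safe #-}
module Submission where

open import Defs
open import Data.Empty using (⊥-elim)
open import Data.Fin using (Fin)
open import Data.Fin.Properties using (any?) renaming (_≟_ to _≟ᶠ_)
open import Data.Maybe using (just)
import Data.Maybe.Properties as Maybe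
open import Data.Nat using (ℕ; zero; suc; _+_; _<_; _≤_; s≤s)
open import Data.Nat.Induction using (<-wellFounded)
open import Data.Nat.Properties
  using (≤-refl; ≤-trans; ≤-reflexive; <⇒≤; <⇒≱; <-≤-trans; +-comm; m≤m+n; +-mono-≤; +-monoʳ-<; +-monoˡ-<)
open import Data.Product using (∃; ∃-syntax; _×_; _,_; proj₁; proj₂)
import Data.Product.Properties as Product
open import Data.Sign using (Sign)
open import Data.Sum using (_⊎_; inj₁; inj₂; [_,_]′)
import Data.Sum.Properties as Sum
open import Function using (_∘_; id; flip)
open import Induction.WellFounded using (Acc; acc)
open import Level using (0ℓ)
open import Relation.Binary.Core using (Rel)
open import Relation.Binary.Definitions using (DecidableEquality)
open import Relation.Binary.PropositionalEquality using (_≡_; _≢_; refl; sym; trans; cong)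
open import Relation.Binary.Rewriting using (Deterministic)
open import Relation.Binary.Construct.Closure.ReflexiveTransitive using (Star; ε; _◅_; _◅◅_; reverse)
open import Relation.Nullary using (¬_; Dec; yes; no)
open import Relation.Nullary.Decidable using (map′; decidable-stable; _×-dec_; _⊎-dec_; _→-dec_; ¬?)

-- The extended order ⪯ is a forest order: a rank (twice the depth on vertices)
-- strictly increases along its generating steps, so it is antisymmetric, and
-- every element has at most one immediate predecessor, so any two elements
-- below a common one are comparable. Let e₁ ≠ e₂ leave x and let
-- f ∈ Interlaced(e₁,e₂) ∩ L(v). Both e₁ and v lie below f, and v ⪯ e₁ is
-- impossible: it would give v ⪯ x ≺ e₂, hence low(v) ⪯ low(e₂) ≺ low(f) = low(v).
-- So e₁ ⪯ v, and all of L(v) lies in Interlaced(e₁,e₂). Recoloring with + every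
-- back-edge lying in no Interlaced set therefore keeps the F-coloring and makes
-- every L(v) monochromatic.

Searchable : Set → Set₁
Searchable A = ∀ {P : A → Set} → (∀ a → Dec (P a)) → Dec (∃ P)

⊎-searchable : ∀ {A B} → Searchable A → Searchable B → Searchable (A ⊎ B)
⊎-searchable searchA searchB {P} P? =
  map′ [ (λ (a , p) → inj₁ a , p) , (λ (b , p) → inj₂ b , p) ]′ split
       (searchA (P? ∘ inj₁) ⊎-dec searchB (P? ∘ inj₂))
  where
  split : ∃ P → ∃ (P ∘ inj₁) ⊎ ∃ (P ∘ inj₂)
  split (inj₁ a , p) = inj₁ (a , p)
  split (inj₂ b , p) = inj₂ (b , p)

searchable⇒all? : ∀ {A} → Searchable A → ∀ {P : A → Set} → (∀ a → Dec (P a)) → Dec (∀ a → P a)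
searchable⇒all? search P? with search (¬? ∘ P?)
... | yes (a , ¬pa) = no (λ all → ¬pa (all a))
... | no ¬counterexample = yes (λ a → decidable-stable (P? a) (λ ¬pa → ¬counterexample (a , ¬pa)))

Star-unsnoc : ∀ {A : Set} {R : Rel A 0ℓ} {a c} → Star R a c → a ≡ c ⊎ ∃[ b ] (Star R a b × R b c)
Star-unsnoc ε = inj₁ refl
Star-unsnoc (r ◅ s) with Star-unsnoc s
... | inj₁ refl = inj₂ (_ , ε , r)
... | inj₂ (b , s′ , r′) = inj₂ (b , r ◅ s′ , r′)

module DeterministicStar {A : Set} {S : Rel A 0ℓ} (S-deterministic : Deterministic _≡_ S) where

  length : ∀ {a b} → Star S a b → ℕ
  length ε = zero
  length (_ ◅ p) = suc (length p)

  Star-comparable : ∀ {a b c} → Star S a b → Star S a c → Star S b c ⊎ Star S c b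
  Star-comparable ε q = inj₁ q
  Star-comparable p@(_ ◅ _) ε = inj₂ p
  Star-comparable (s ◅ p) (s′ ◅ q) with S-deterministic s s′
  ... | refl = Star-comparable p q

  length-unique : ∀ {a z} → (∀ {b} → ¬ S z b) → (p q : Star S a z) → length p ≡ length q
  length-unique stuck ε ε = refl
  length-unique stuck ε (s ◅ _) = ⊥-elim (stuck s)
  length-unique stuck (s ◅ _) ε = ⊥-elim (stuck s)
  length-unique stuck (s ◅ p) (s′ ◅ q) with S-deterministic s s′
  ... | refl = cong suc (length-unique stuck p q)

module StrictlyRanked {A : Set} {R : Rel A 0ℓ}
                      (rank : A → ℕ) (rank-< : ∀ {a b} → R a b → rank a < rank b) where

  Star⇒rank≤ : ∀ {a b} → Star R a b → rank a ≤ rank b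
  Star⇒rank≤ ε = ≤-refl
  Star⇒rank≤ (r ◅ s) = ≤-trans (<⇒≤ (rank-< r)) (Star⇒rank≤ s)

  Star-≢⇒rank< : ∀ {a b} → Star R a b → a ≢ b → rank a < rank b
  Star-≢⇒rank< ε a≢a = ⊥-elim (a≢a refl)
  Star-≢⇒rank< (r ◅ s) _ = <-≤-trans (rank-< r) (Star⇒rank≤ s)

  Star-antisym : ∀ {a b} → Star R a b → Star R b a → a ≡ b
  Star-antisym ε _ = refl
  Star-antisym (r ◅ s) t = ⊥-elim (<⇒≱ (<-≤-trans (rank-< r) (Star⇒rank≤ s)) (Star⇒rank≤ t))

  Star? : DecidableEquality A → Searchable A → (∀ a b → Dec (R a b)) → ∀ a b → Dec (Star R a b)
  Star? _≟_ search R? a b = reachable? b (<-wellFounded (rank b))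
    where
    reachable? : ∀ b → Acc _<_ (rank b) → Dec (Star R a b)
    reachable? b (acc below) with a ≟ b
    ... | yes refl = yes ε
    ... | no a≢b = map′ (λ (_ , s , r) → s ◅◅ r ◅ ε) (λ s → [ ⊥-elim ∘ a≢b , id ]′ (Star-unsnoc s))
                        (search reachable-predecessor?)
      where
      reachable-predecessor? : ∀ b′ → Dec (Star R a b′ × R b′ b)
      reachable-predecessor? b′ with R? b′ b
      ... | yes r = map′ (_, r) proj₁ (reachable? b′ (below (rank-< r)))
      ... | no ¬r = no (¬r ∘ proj₂)

module _ {n m : ℕ} {G : Multigraph n m} (T : RootedSpanningTree G) where

  Constrained : Fin m → Set
  Constrained f = ∃[ x ] ∃[ e₁ ] ∃[ e₂ ] (OutOf T x e₁ × OutOf T x e₂ × e₁ ≢ e₂ × Interlaced T e₁ e₂ f)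

  FColoring-cong : ∀ {λ₁ λ₂} → (∀ f → Constrained f → λ₁ f ≡ λ₂ f) → FColoring T λ₁ → FColoring T λ₂
  FColoring-cong {λ₁} {λ₂} agree F x e₁ e₂ out₁ out₂ e₁≢e₂ with F x e₁ e₂ out₁ out₂ e₁≢e₂
  ... | same₁₂ , same₂₁ , differ =
      (λ f g If Ig → transport (constrained₁₂ If) (constrained₁₂ Ig) (same₁₂ f g If Ig))
    , (λ f g If Ig → transport (constrained₂₁ If) (constrained₂₁ Ig) (same₂₁ f g If Ig))
    , (λ f g If Ig → differ f g If Ig ∘ transport⁻¹ (constrained₁₂ If) (constrained₂₁ Ig))
    where
    constrained₁₂ : ∀ {f} → Interlaced T e₁ e₂ f → Constrained f
    constrained₁₂ I = x , e₁ , e₂ , out₁ , out₂ , e₁≢e₂ , I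

    constrained₂₁ : ∀ {f} → Interlaced T e₂ e₁ f → Constrained f
    constrained₂₁ I = x , e₂ , e₁ , out₂ , out₁ , e₁≢e₂ ∘ sym , I

    transport : ∀ {f g} → Constrained f → Constrained g → λ₁ f ≡ λ₁ g → λ₂ f ≡ λ₂ g
    transport {f} {g} cf cg eq = trans (sym (agree f cf)) (trans eq (agree g cg))

    transport⁻¹ : ∀ {f g} → Constrained f → Constrained g → λ₂ f ≡ λ₂ g → λ₁ f ≡ λ₁ g
    transport⁻¹ {f} {g} cf cg eq = trans (agree f cf) (trans eq (sym (agree g cg)))

module _ {n m : ℕ} {G : Multigraph n m} (loopless : Loopless G) (T : RootedSpanningTree G) where
  open Multigraph G
  open RootedSpanningTree T

  Joins-irrefl : ∀ {e x y} → Joins G e x y → x ≢ y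
  Joins-irrefl {e} (inj₁ eq) refl = loopless e (trans (cong proj₁ eq) (sym (cong proj₂ eq)))
  Joins-irrefl {e} (inj₂ eq) refl = loopless e (trans (cong proj₁ eq) (sym (cong proj₂ eq)))

  Joins-unique : ∀ {e x y x′ y′} → Joins G e x y → Joins G e x′ y′ →
                 (x ≡ x′ × y ≡ y′) ⊎ (x ≡ y′ × y ≡ x′)
  Joins-unique (inj₁ p) (inj₁ q) = let r = trans (sym p) q in inj₁ (cong proj₁ r , cong proj₂ r)
  Joins-unique (inj₁ p) (inj₂ q) = let r = trans (sym p) q in inj₂ (cong proj₁ r , cong proj₂ r)
  Joins-unique (inj₂ p) (inj₁ q) = let r = trans (sym p) q in inj₂ (cong proj₂ r , cong proj₁ r)
  Joins-unique (inj₂ p) (inj₂ q) = let r = trans (sym p) q in inj₁ (cong proj₂ r , cong proj₁ r)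

  Parent-unique : ∀ {p p′ c} → Parent p c → Parent p′ c → p ≡ p′
  Parent-unique (_ , up≡e , j) (_ , up≡e′ , j′) with Maybe.just-injective (trans (sym up≡e) up≡e′)
  ... | refl with Joins-unique j j′
  ...   | inj₁ (p≡p′ , _) = p≡p′
  ...   | inj₂ (p≡c , _) = ⊥-elim (Joins-irrefl j p≡c)

  root-orphan : ∀ {p} → ¬ Parent p root
  root-orphan (_ , up≡e , _) with trans (sym up-root) up≡e
  ... | ()

  module Climb = DeterministicStar {S = flip Parent} Parent-unique

  depth : Fin n → ℕ
  depth v = Climb.length (reverse id (reaches-root v))

  Parent⇒depth< : ∀ {p c} → Parent p c → depth p < depth c
  Parent⇒depth< {p} {c} r =
    ≤-reflexive (Climb.length-unique root-orphan
                   (r ◅ reverse id (reaches-root p)) (reverse id (reaches-root c)))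

  module Ancestry = StrictlyRanked depth Parent⇒depth<

  orientations-exclusive : ∀ {e x y} →
    (IsTree T e × Anc x y) ⊎ (IsBack T e × Anc y x) →
    (IsTree T e × Anc y x) ⊎ (IsBack T e × Anc x y) → x ≡ y
  orientations-exclusive (inj₁ (_ , x⪯y)) (inj₁ (_ , y⪯x)) = Ancestry.Star-antisym x⪯y y⪯x
  orientations-exclusive (inj₂ (_ , y⪯x)) (inj₂ (_ , x⪯y)) = Ancestry.Star-antisym x⪯y y⪯x
  orientations-exclusive (inj₁ (tree , _)) (inj₂ (back , _)) = ⊥-elim (back tree)
  orientations-exclusive (inj₂ (back , _)) (inj₁ (tree , _)) = ⊥-elim (back tree)

  Oriented-tail-unique : ∀ {e x y x′ y′} → Oriented T e x y → Oriented T e x′ y′ → x ≡ x′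
  Oriented-tail-unique (j , o) (j′ , o′) with Joins-unique j j′
  ... | inj₁ (x≡x′ , _) = x≡x′
  ... | inj₂ (refl , refl) = ⊥-elim (Joins-irrefl j (orientations-exclusive o o′))

  Oriented⇒depth< : ∀ {e x y} → IsTree T e → Oriented T e x y → depth x < depth y
  Oriented⇒depth< tree (j , inj₁ (_ , x⪯y)) = Ancestry.Star-≢⇒rank< x⪯y (Joins-irrefl j)
  Oriented⇒depth< tree (j , inj₂ (back , _)) = ⊥-elim (back tree)

  up⇒head : ∀ {e x y c} → up c ≡ just e → Oriented T e x y → c ≡ y
  up⇒head {c = c} up≡e o@(j , _) with up-incid c _ up≡e
  ... | _ , j′ with Joins-unique j j′
  ...   | inj₁ (_ , y≡c) = sym y≡c
  ...   | inj₂ (refl , refl) =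
    ⊥-elim (<⇒≱ (Parent⇒depth< (_ , up≡e , j′)) (<⇒≤ (Oriented⇒depth< (c , up≡e) o)))

  tree-edge-into-unique : ∀ {e e′ x x′ y} → IsTree T e → Oriented T e x y →
                          IsTree T e′ → Oriented T e′ x′ y → e ≡ e′
  tree-edge-into-unique (_ , up≡e) o (_ , up≡e′) o′ with up⇒head up≡e o | up⇒head up≡e′ o′
  ... | refl | refl = Maybe.just-injective (trans (sym up≡e) up≡e′)

  Step-predecessor-unique : ∀ {a a′ c} → Step T a c → Step T a′ c → a ≡ a′
  Step-predecessor-unique (tail≺e o) (tail≺e o′) = cong inj₁ (Oriented-tail-unique o o′)
  Step-predecessor-unique (e≺head t o) (e≺head t′ o′) = cong inj₂ (tree-edge-into-unique t o t′ o′)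

  IsTree? : ∀ e → Dec (IsTree T e)
  IsTree? e = any? (λ v → Maybe.≡-dec _≟ᶠ_ (up v) (just e))

  endDepths : Fin m → ℕ
  endDepths e = depth (proj₁ (ends e)) + depth (proj₂ (ends e))

  Joins⇒endDepths : ∀ {e x y} → Joins G e x y → endDepths e ≡ depth x + depth y
  Joins⇒endDepths (inj₁ eq) rewrite eq = refl
  Joins⇒endDepths {x = x} {y} (inj₂ eq) rewrite eq = +-comm (depth y) (depth x)

  -- A tree edge p → c gets depth p + depth c = 2 depth p + 1, strictly between
  -- the ranks of its ends; a back-edge gets more than twice the depth of either end.
  rank : Elt T → ℕ
  rank (inj₁ v) = depth v + depth v
  rank (inj₂ e) with IsTree? e
  ... | yes _ = endDepths e
  ... | no _ = suc (endDepths e + endDepths e)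

  Step⇒rank< : ∀ {a b} → Step T a b → rank a < rank b
  Step⇒rank< (tail≺e {x} {e} o@(j , _)) with IsTree? e
  ... | yes tree rewrite Joins⇒endDepths j = +-monoʳ-< (depth x) (Oriented⇒depth< tree o)
  ... | no _ rewrite Joins⇒endDepths j = s≤s (+-mono-≤ (m≤m+n (depth x) _) (m≤m+n (depth x) _))
  Step⇒rank< (e≺head {e = e} {y} tree o@(j , _)) with IsTree? e
  ... | yes _ rewrite Joins⇒endDepths j = +-monoˡ-< (depth y) (Oriented⇒depth< tree o)
  ... | no back = ⊥-elim (back tree)

  module Order = StrictlyRanked {R = Step T} rank Step⇒rank<
  module Descent = DeterministicStar {S = flip (Step T)} Step-predecessor-unique

  ≺⇒⋡ : ∀ {a b} → _≺_ T a b → ¬ _⪯_ T b a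
  ≺⇒⋡ (a⪯b , a≢b) b⪯a = a≢b (Order.Star-antisym a⪯b b⪯a)

  ⪯-comparable : ∀ {a b c} → _⪯_ T a c → _⪯_ T b c → _⪯_ T a b ⊎ _⪯_ T b a
  ⪯-comparable a⪯c b⪯c =
    [ inj₂ ∘ reverse id , inj₁ ∘ reverse id ]′
      (Descent.Star-comparable (reverse id a⪯c) (reverse id b⪯c))

  ⪯-edge⇒⪯-tail : ∀ {x e v} → OutOf T x e → _⪯_ T (inj₁ v) (inj₂ e) → _⪯_ T (inj₁ v) (inj₁ x)
  ⪯-edge⇒⪯-tail (_ , o) v⪯e with Star-unsnoc v⪯e
  ... | inj₂ (_ , v⪯x′ , tail≺e o′) with Oriented-tail-unique o′ o
  ...   | refl = v⪯x′

  IsLow-unique : ∀ {α β β′} → IsLow T α β → IsLow T α β′ → β ≡ β′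
  IsLow-unique (β∈ , β-min) (β′∈ , β′-min) = Order.Star-antisym (β-min _ β′∈) (β′-min _ β∈)

  IsLow-mono : ∀ {α α′ β β′} → _⪯_ T α α′ → IsLow T α β → IsLow T α′ β′ → _⪯_ T β β′
  IsLow-mono α⪯α′ (_ , β-min) (inj₁ refl , _) = β-min _ (inj₁ refl) ◅◅ α⪯α′
  IsLow-mono α⪯α′ (_ , β-min) (inj₂ (v , refl , f , u , back , o , α′⪯f) , _) =
    β-min _ (inj₂ (v , refl , f , u , back , o , α⪯α′ ◅◅ α′⪯f))

  LowSetOf-⊆-Interlaced : ∀ {x e₁ e₂ v f g} → OutOf T x e₁ → OutOf T x e₂ →
    Interlaced T e₁ e₂ f → LowSetOf T v f → LowSetOf T v g → Interlaced T e₁ e₂ g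
  LowSetOf-⊆-Interlaced out₁ (_ , o₂)
      ((_ , e₁⪯f , x′ , out′ , β , low-f , β≺x′) , β′ , γ , low-f′ , low-e₂ , γ≺β′)
      (_ , v⪯f , _ , low-f″ , low-v) (back-g , v⪯g , _ , low-g , low-v′)
    with IsLow-unique low-f low-f″ | IsLow-unique low-f′ low-f″ | IsLow-unique low-v′ low-v
  ... | refl | refl | refl =
    (back-g , e₁⪯g , x′ , out′ , β , low-g , β≺x′) , β , γ , low-g , low-e₂ , γ≺β′
    where
    v⋠e₁ : ¬ _⪯_ T (inj₁ _) (inj₂ _)
    v⋠e₁ v⪯e₁ = ≺⇒⋡ γ≺β′ (IsLow-mono (⪯-edge⇒⪯-tail out₁ v⪯e₁ ◅◅ tail≺e o₂ ◅ ε) low-v low-e₂)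

    e₁⪯g : _⪯_ T (inj₂ _) (inj₂ _)
    e₁⪯g = [ _◅◅ v⪯g , ⊥-elim ∘ v⋠e₁ ]′ (⪯-comparable e₁⪯f v⪯f)

  -- Constructively, the recoloring below must decide whether a back-edge lies in
  -- some Interlaced set; every notion involved is a finite search or
  -- reachability in one of the two ranked orders.
  Elt-searchable : Searchable (Elt T)
  Elt-searchable = ⊎-searchable any? any?

  _≟ᴱ_ : DecidableEquality (Elt T)
  _≟ᴱ_ = Sum.≡-dec _≟ᶠ_ _≟ᶠ_

  IsBack? : ∀ e → Dec (IsBack T e)
  IsBack? = ¬? ∘ IsTree?

  Joins? : ∀ e x y → Dec (Joins G e x y)
  Joins? e x y = ends e ≟² (x , y) ⊎-dec ends e ≟² (y , x)
    where
    _≟²_ : DecidableEquality (Fin n × Fin n)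
    _≟²_ = Product.≡-dec _≟ᶠ_ _≟ᶠ_

  Parent? : ∀ p c → Dec (Parent p c)
  Parent? p c = any? (λ e → Maybe.≡-dec _≟ᶠ_ (up c) (just e) ×-dec Joins? e p c)

  Anc? : ∀ x y → Dec (Anc x y)
  Anc? = Ancestry.Star? _≟ᶠ_ any? Parent?

  Oriented? : ∀ e x y → Dec (Oriented T e x y)
  Oriented? e x y = Joins? e x y ×-dec ((IsTree? e ×-dec Anc? x y) ⊎-dec (IsBack? e ×-dec Anc? y x))

  OutOf? : ∀ v e → Dec (OutOf T v e)
  OutOf? v e = any? (Oriented? e v)

  Step? : ∀ a b → Dec (Step T a b)
  Step? (inj₁ x) (inj₂ e) = map′ (tail≺e ∘ proj₂) (λ { (tail≺e o) → _ , o }) (OutOf? x e)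
  Step? (inj₂ e) (inj₁ y) =
    map′ (λ (_ , t , o) → e≺head t o) (λ { (e≺head t o) → _ , t , o })
         (any? (λ x → IsTree? e ×-dec Oriented? e x y))
  Step? (inj₁ _) (inj₁ _) = no λ ()
  Step? (inj₂ _) (inj₂ _) = no λ ()

  _⪯?_ : ∀ a b → Dec (_⪯_ T a b)
  _⪯?_ = Order.Star? _≟ᴱ_ Elt-searchable Step?

  _≺?_ : ∀ a b → Dec (_≺_ T a b)
  a ≺? b = (a ⪯? b) ×-dec ¬? (a ≟ᴱ b)

  LowSet? : ∀ α β → Dec (LowSet T α β)
  LowSet? α β = β ≟ᴱ α ⊎-dec any? (λ v → β ≟ᴱ inj₁ v ×-dec any? (λ f → any? (λ u →
    IsBack? f ×-dec Oriented? f u v ×-dec α ⪯? inj₂ f)))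

  IsLow? : ∀ α β → Dec (IsLow T α β)
  IsLow? α β = LowSet? α β ×-dec searchable⇒all? Elt-searchable (λ γ → LowSet? α γ →-dec β ⪯? γ)

  Fringe? : ∀ e f → Dec (Fringe T e f)
  Fringe? e f = IsBack? f ×-dec inj₂ e ⪯? inj₂ f ×-dec
    any? (λ x → OutOf? x e ×-dec Elt-searchable (λ β → IsLow? (inj₂ f) β ×-dec β ≺? inj₁ x))

  Interlaced? : ∀ e₁ e₂ f → Dec (Interlaced T e₁ e₂ f)
  Interlaced? e₁ e₂ f = Fringe? e₁ f ×-dec Elt-searchable (λ β → Elt-searchable (λ γ →
    IsLow? (inj₂ f) β ×-dec IsLow? (inj₂ e₂) γ ×-dec γ ≺? β))

  Constrained? : ∀ f → Dec (Constrained T f)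
  Constrained? f = any? (λ x → any? (λ e₁ → any? (λ e₂ →
    OutOf? x e₁ ×-dec OutOf? x e₂ ×-dec ¬? (e₁ ≟ᶠ e₂) ×-dec Interlaced? e₁ e₂ f)))

  recolor : (Fin m → Sign) → Fin m → Sign
  recolor λc f with Constrained? f
  ... | yes _ = λc f
  ... | no _ = Sign.+

  recolor-constrained : ∀ λc f → Constrained T f → recolor λc f ≡ λc f
  recolor-constrained λc f cf with Constrained? f
  ... | yes _ = refl
  ... | no ¬cf = ⊥-elim (¬cf cf)

  LowSetOf-Constrained : ∀ {v f g} → LowSetOf T v f → LowSetOf T v g → Constrained T f → Constrained T g
  LowSetOf-Constrained Lf Lg (x , e₁ , e₂ , out₁ , out₂ , e₁≢e₂ , I) =
    x , e₁ , e₂ , out₁ , out₂ , e₁≢e₂ , LowSetOf-⊆-Interlaced out₁ out₂ I Lf Lg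

  recolor-LowSetOf : ∀ {λc} → FColoring T λc → ∀ v f g → LowSetOf T v f → LowSetOf T v g →
                     recolor λc f ≡ recolor λc g
  recolor-LowSetOf F v f g Lf Lg with Constrained? f | Constrained? g
  ... | yes (x , e₁ , e₂ , out₁ , out₂ , e₁≢e₂ , I) | yes _ =
    proj₁ (F x e₁ e₂ out₁ out₂ e₁≢e₂) f g I (LowSetOf-⊆-Interlaced out₁ out₂ I Lf Lg)
  ... | yes cf | no ¬cg = ⊥-elim (¬cg (LowSetOf-Constrained Lf Lg cf))
  ... | no ¬cf | yes cg = ⊥-elim (¬cf (LowSetOf-Constrained Lg Lf cg))
  ... | no _ | no _ = refl

  recolor-StrongFColoring : ∀ {λc} → FColoring T λc → StrongFColoring T (recolor λc)
  recolor-StrongFColoring {λc} F =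
    FColoring-cong T (λ f cf → sym (recolor-constrained λc f cf)) F , recolor-LowSetOf F

mainTheorem2 : ∀ {n m : ℕ} (G : Multigraph n m) → Loopless G → Connected G →
    (T : RootedSpanningTree G) → Tremaux T →
    (∃[ λc ] FColoring T λc) → ∃[ λc ] StrongFColoring T λc
mainTheorem2 G loopless _ T _ (λc , F) = recolor loopless T λc , recolor-StrongFColoring loopless T F
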